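{- Let $G$ be a connected graph of order $n \geq 3$ such that $\gamma_R(G) = \gamma(G) + 1$. If $B \subseteq E(G)$ is a set of edges with $\gamma_R(G - B) = \gamma_R(G)$, then $\Delta(G) = \Delta(G - B)$.
   Context: All graphs are finite and simple. A dominating set of $G$ is a set $S \subseteq V(G)$ such that every vertex outside $S$ has a neighbor in $S$; $\gamma(G)$ is the minimum cardinality of a dominating set. A Roman dominating function on $G$ is a function $f: V(G) \to \{0,1,2\}$ such that every vertex $v$ with $f(v)=0$ has a neighbor $u$ with $f(u)=2$; its weight is $\sum_v f(v)$, and $\gamma_R(G)$ is the minimum weight of such a function. $G - B$ denotes the graph obtained by deleting the edges in $B$ (keeping all vertices). $\Delta$ denotes maximum degree. -}

module Defs where

open import Data.Nat using (ℕ; zero; suc; _+_; _≤_; _⊔_)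
open import Data.Bool using (Bool; true; false; _∧_; _∨_; not; if_then_else_)
open import Data.Bool.Properties using (∨-comm)
open import Data.Fin using (Fin; toℕ)
open import Data.Fin.Subset using (Subset; _∈_; _∉_; ∣_∣)
open import Data.List using (List; map; foldr; allFin)
open import Data.Nat.ListAction using (sum)
open import Data.Product using (Σ; _×_; ∃; ∃-syntax; _,_)
open import Relation.Binary.PropositionalEquality using (_≡_; refl; cong₂)

record Graph (n : ℕ) : Set where
  field
    adj    : Fin n → Fin n → Bool
    sym    : ∀ u v → adj u v ≡ adj v u
    irrefl : ∀ v → adj v v ≡ false
open Graph public

Adj : ∀ {n} → Graph n → Fin n → Fin n → Set
Adj G u v = adj G u v ≡ true

-- A set of edges B, given as a Boolean relation; the unordered edge {u,v}
-- belongs to B iff B u v ∨ B v u.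
EdgeSet : ℕ → Set
EdgeSet n = Fin n → Fin n → Bool

InEdgeSet : ∀ {n} → EdgeSet n → Fin n → Fin n → Set
InEdgeSet B u v = (B u v ∨ B v u) ≡ true

_⊆E_ : ∀ {n} → EdgeSet n → Graph n → Set
B ⊆E G = ∀ u v → InEdgeSet B u v → Adj G u v

_─_ : ∀ {n} → Graph n → EdgeSet n → Graph n
adj (G ─ B) u v = adj G u v ∧ not (B u v ∨ B v u)
sym (G ─ B) u v = cong₂ (λ a b → a ∧ not b) (sym G u v) (∨-comm (B u v) (B v u))
irrefl (G ─ B) v rewrite irrefl G v = refl

data Reach {n} (G : Graph n) : Fin n → Fin n → Set where
  here : ∀ {v} → Reach G v v
  step : ∀ {u w v} → Adj G u w → Reach G w v → Reach G u v

Connected : ∀ {n} → Graph n → Set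
Connected G = ∀ u v → Reach G u v

degree : ∀ {n} → Graph n → Fin n → ℕ
degree {n} G u = sum (map (λ v → if adj G u v then 1 else 0) (allFin n))

Δ : ∀ {n} → Graph n → ℕ
Δ {n} G = foldr _⊔_ 0 (map (degree G) (allFin n))

IsDominatingSet : ∀ {n} → Graph n → Subset n → Set
IsDominatingSet G S = ∀ v → v ∉ S → ∃[ u ] (u ∈ S × Adj G u v)

IsDominationNumber : ∀ {n} → Graph n → ℕ → Set
IsDominationNumber G k =
  (∃[ S ] (IsDominatingSet G S × ∣ S ∣ ≡ k))
  × (∀ S → IsDominatingSet G S → k ≤ ∣ S ∣)

weight : ∀ {n} → (Fin n → Fin 3) → ℕ
weight {n} f = sum (map (λ v → toℕ (f v)) (allFin n))

IsRomanDominatingFunction : ∀ {n} → Graph n → (Fin n → Fin 3) → Set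
IsRomanDominatingFunction G f =
  ∀ v → toℕ (f v) ≡ 0 → ∃[ u ] (Adj G u v × toℕ (f u) ≡ 2)

IsRomanDominationNumber : ∀ {n} → Graph n → ℕ → Set
IsRomanDominationNumber G k =
  (∃[ f ] (IsRomanDominatingFunction G f × weight f ≡ k))
  × (∀ f → IsRomanDominatingFunction G f → k ≤ weight f)

-- Let f be a Roman dominating function of G − B of weight γ_R(G) = γ(G) + 1, and let
-- V₂ = f⁻¹(2), V⁺ = f⁻¹{1,2}.  Every 0-vertex has a neighbour in V₂, so V⁺ dominates G
-- and γ(G) ≤ |V⁺|; as w(f) = |V⁺| + |V₂| this forces |V₂| ≤ 1.  If V₂ = ∅ then f ≡ 1,
-- so γ(G) = n − 1; but V(G) ∖ N(u) dominates G, so deg u + γ(G) ≤ n and every degree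
-- would be at most 1, impossible for a connected graph on ≥ 3 vertices.  Hence
-- V₂ = {v} and |V⁺| = γ(G); all of V ∖ V⁺ lies in the (G − B)-neighbourhood of v, so
-- deg_G u + γ(G) ≤ n ≤ deg_{G−B} v + γ(G) for every u, i.e. Δ(G) ≤ Δ(G − B).
module Submission where

open import Defs
open import Data.Nat using (ℕ; _+_; _≥_)
open import Relation.Binary.PropositionalEquality using (_≡_)

open import Data.Bool using (Bool; true; false; not; if_then_else_)
open import Data.Empty using (⊥-elim)
open import Data.Fin using (Fin; zero; suc; toℕ; punchIn; punchOut)
open import Data.Fin.Properties using (any?; punchIn-punchOut; _≟_)
open import Data.Fin.Subset using (Subset; _∈_; _∉_; ∣_∣)
open import Data.List using (map; allFin)
import Data.List as List
open import Data.List.Properties using (map-tabulate; foldr-preservesᵇ; foldr-preservesᵒ)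
import Data.List.Relation.Unary.All.Properties as All
import Data.List.Relation.Unary.Any.Properties as Any
import Data.Nat as ℕ
import Data.Nat.ListAction as ListAction
open import Data.Nat using (zero; suc; _≤_; _⊔_; z≤n; s≤s)
open import Data.Nat.Properties hiding (_≟_)
open import Algebra.Properties.CommutativeMonoid.Sum +-0-commutativeMonoid
  using (sum; sum-syntax; sum-cong-≗; sum-remove; ∑-distrib-+)
open import Data.Product using (_,_)
open import Data.Sum using (_⊎_; inj₁; inj₂; [_,_])
import Data.Vec as Vec
open import Data.Vec.Properties using (lookup⇒[]=; lookup∘tabulate)
open import Function using (_∘_; id)
open import Relation.Nullary using (¬_; yes; no)
open import Relation.Binary.PropositionalEquality
  using (_≢_; refl; trans; cong; cong₂; subst; module ≡-Reasoning)
import Relation.Binary.PropositionalEquality as ≡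

𝟙 : Bool → ℕ
𝟙 b = if b then 1 else 0

sum-tabulate : ∀ {n} (h : Fin n → ℕ) → ListAction.sum (List.tabulate h) ≡ sum h
sum-tabulate {zero}  h = refl
sum-tabulate {suc n} h = cong (h zero +_) (sum-tabulate (h ∘ suc))

sum-map-allFin : ∀ {n} (h : Fin n → ℕ) → ListAction.sum (map h (allFin n)) ≡ sum h
sum-map-allFin h = trans (cong ListAction.sum (map-tabulate id h)) (sum-tabulate h)

sum-mono-≤ : ∀ {n} {h k : Fin n → ℕ} → (∀ i → h i ≤ k i) → sum h ≤ sum k
sum-mono-≤ {zero}  h≤k = z≤n
sum-mono-≤ {suc n} h≤k = +-mono-≤ (h≤k zero) (sum-mono-≤ (h≤k ∘ suc))

sum-ones : ∀ n → ∑[ i < n ] 1 ≡ n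
sum-ones zero    = refl
sum-ones (suc n) = cong suc (sum-ones n)

≤-sum : ∀ {n} (h : Fin n → ℕ) i → h i ≤ sum h
≤-sum h zero    = m≤m+n _ _
≤-sum h (suc i) = ≤-trans (≤-sum (h ∘ suc) i) (m≤n+m _ _)

+-≤-sum : ∀ {n} (h : Fin n → ℕ) {i j} → i ≢ j → h i + h j ≤ sum h
+-≤-sum {suc n} h {i} {j} i≢j = begin
  h i + h j                             ≡⟨ cong (λ k → h i + h k) (punchIn-punchOut i≢j) ⟨
  h i + h (punchIn i (punchOut i≢j))   ≤⟨ +-monoʳ-≤ (h i) (≤-sum (h ∘ punchIn i) (punchOut i≢j)) ⟩
  h i + sum (h ∘ punchIn i)            ≡⟨ sum-remove {i = i} h ⟨
  sum h                                 ∎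
  where open ≤-Reasoning

sum-𝟙+sum-𝟙-not : ∀ {n} (c : Fin n → Bool) → ∑[ i < n ] 𝟙 (c i) + ∑[ i < n ] 𝟙 (not (c i)) ≡ n
sum-𝟙+sum-𝟙-not {n} c = begin
  ∑[ i < n ] 𝟙 (c i) + ∑[ i < n ] 𝟙 (not (c i))   ≡⟨ ∑-distrib-+ (𝟙 ∘ c) (𝟙 ∘ not ∘ c) ⟨
  ∑[ i < n ] (𝟙 (c i) + 𝟙 (not (c i)))           ≡⟨ sum-cong-≗ (λ i → 𝟙+𝟙-not (c i)) ⟩
  ∑[ i < n ] 1                                   ≡⟨ sum-ones n ⟩
  n                                              ∎
  where
  open ≡-Reasoning
  𝟙+𝟙-not : ∀ b → 𝟙 b + 𝟙 (not b) ≡ 1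
  𝟙+𝟙-not true  = refl
  𝟙+𝟙-not false = refl

sum-𝟙-cover : ∀ {n} (c d : Fin n → Bool) → (∀ i → c i ≡ false → d i ≡ true) →
  n ≤ ∑[ i < n ] 𝟙 (c i) + ∑[ i < n ] 𝟙 (d i)
sum-𝟙-cover {n} c d cover = begin
  n                                        ≡⟨ sum-ones n ⟨
  ∑[ i < n ] 1                             ≤⟨ sum-mono-≤ one≤ ⟩
  ∑[ i < n ] (𝟙 (c i) + 𝟙 (d i))           ≡⟨ ∑-distrib-+ (𝟙 ∘ c) (𝟙 ∘ d) ⟩
  ∑[ i < n ] 𝟙 (c i) + ∑[ i < n ] 𝟙 (d i)  ∎
  where
  open ≤-Reasoning
  one≤ : ∀ i → 1 ≤ 𝟙 (c i) + 𝟙 (d i)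
  one≤ i with c i in ci
  ... | true  = s≤s z≤n
  ... | false rewrite cover i ci = s≤s z≤n

∈-tabulate : ∀ {n} (c : Fin n → Bool) {x} → c x ≡ true → x ∈ Vec.tabulate c
∈-tabulate c {x} cx = lookup⇒[]= x (Vec.tabulate c) (trans (lookup∘tabulate c x) cx)

∉-tabulate : ∀ {n} (c : Fin n → Bool) {x} → x ∉ Vec.tabulate c → c x ≡ false
∉-tabulate c {x} x∉ with c x in cx
... | true  = ⊥-elim (x∉ (∈-tabulate c cx))
... | false = refl

∣tabulate∣ : ∀ {n} (c : Fin n → Bool) → ∣ Vec.tabulate c ∣ ≡ ∑[ i < n ] 𝟙 (c i)
∣tabulate∣ {zero}  c = refl
∣tabulate∣ {suc n} c with c zero
... | true  = cong suc (∣tabulate∣ (c ∘ suc))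
... | false = ∣tabulate∣ (c ∘ suc)

degree≡sum : ∀ {n} (G : Graph n) u → degree G u ≡ ∑[ v < n ] 𝟙 (adj G u v)
degree≡sum G u = sum-map-allFin (𝟙 ∘ adj G u)

degree≤Δ : ∀ {n} (G : Graph n) u → degree G u ≤ Δ G
degree≤Δ {n} G u = foldr-preservesᵒ {P = degree G u ≤_}
  (λ x y → [ (λ p → ≤-trans p (m≤m⊔n x y)) , (λ p → ≤-trans p (m≤n⊔m x y)) ])
  0 (map (degree G) (allFin n)) (inj₂ (Any.map⁺ (Any.tabulate⁺ u ≤-refl)))

Δ-lub : ∀ {n} (G : Graph n) {c} → (∀ u → degree G u ≤ c) → Δ G ≤ c
Δ-lub G {c} deg≤c = foldr-preservesᵇ {P = _≤ c} ⊔-lub z≤n (All.map⁺ (All.tabulate⁺ deg≤c))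

adj-sym : ∀ {n} (G : Graph n) {u v} → Adj G u v → Adj G v u
adj-sym G {u} {v} = trans (≡.sym (Graph.sym G u v))

2≤degree : ∀ {n} (G : Graph n) {y p q} → p ≢ q → Adj G y p → Adj G y q → 2 ≤ degree G y
2≤degree G {y} {p} {q} p≢q yp yq = begin
  2                                         ≡⟨ cong₂ (λ a b → 𝟙 a + 𝟙 b) yp yq ⟨
  𝟙 (adj G y p) + 𝟙 (adj G y q)            ≤⟨ +-≤-sum (𝟙 ∘ adj G y) p≢q ⟩
  ∑[ v < _ ] 𝟙 (adj G y v)                 ≡⟨ degree≡sum G y ⟨
  degree G y                                ∎
  where open ≤-Reasoning

infix 4 _⊆G_
record _⊆G_ {n} (H G : Graph n) : Set where
  field adj-⊆ : ∀ {u v} → Adj H u v → Adj G u v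
open _⊆G_

─-⊆G : ∀ {n} (G : Graph n) (B : EdgeSet n) → G ─ B ⊆G G
adj-⊆ (─-⊆G G B) {u} {v} uv with adj G u v
... | true = refl

degree-mono : ∀ {n} {H G : Graph n} → H ⊆G G → ∀ u → degree H u ≤ degree G u
degree-mono {H = H} {G} H⊆G u = begin
  degree H u                   ≡⟨ degree≡sum H u ⟩
  ∑[ v < _ ] 𝟙 (adj H u v)    ≤⟨ sum-mono-≤ 𝟙-mono ⟩
  ∑[ v < _ ] 𝟙 (adj G u v)    ≡⟨ degree≡sum G u ⟨
  degree G u                   ∎
  where
  open ≤-Reasoning
  𝟙-mono : ∀ v → 𝟙 (adj H u v) ≤ 𝟙 (adj G u v)
  𝟙-mono v with adj H u v in uv
  ... | false = z≤n
  ... | true  rewrite adj-⊆ H⊆G uv = ≤-refl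

Δ-mono : ∀ {n} {H G : Graph n} → H ⊆G G → Δ H ≤ Δ G
Δ-mono {H = H} {G} H⊆G = Δ-lub H (λ u → ≤-trans (degree-mono H⊆G u) (degree≤Δ G u))

neighbours-unique : ∀ {n} (G : Graph n) {y p q} → degree G y ≤ 1 → Adj G y p → Adj G y q → p ≡ q
neighbours-unique G {p = p} {q} deg≤1 yp yq with p ≟ q
... | yes p≡q = p≡q
... | no  p≢q = ⊥-elim (1+n≰n (≤-trans (2≤degree G p≢q yp yq) deg≤1))

reach-closed : ∀ {n} (G : Graph n) → (∀ y → degree G y ≤ 1) →
  ∀ {a t} → Reach G a t → t ≡ a ⊎ Adj G a t
reach-closed G deg≤1 here = inj₁ refl
reach-closed G deg≤1 (step aw wt) with reach-closed G deg≤1 wt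
... | inj₁ refl = inj₂ aw
... | inj₂ wt′  = inj₁ (neighbours-unique G (deg≤1 _) wt′ (adj-sym G aw))

connected⇒¬degree≤1 : ∀ {n} (G : Graph n) → n ≥ 3 → Connected G → ¬ (∀ y → degree G y ≤ 1)
connected⇒¬degree≤1 G (s≤s (s≤s (s≤s _))) con deg≤1
  with reach-closed G deg≤1 (con zero (suc zero)) | reach-closed G deg≤1 (con zero (suc (suc zero)))
... | inj₁ () | _
... | inj₂ _  | inj₁ ()
... | inj₂ a₁ | inj₂ a₂ with neighbours-unique G (deg≤1 zero) a₁ a₂
... | ()

degree+γ≤order : ∀ {n} (G : Graph n) {g} → IsDominationNumber G g → ∀ u → degree G u + g ≤ n
degree+γ≤order {n} G {g} (_ , γ-min) u = begin
  degree G u + g                       ≤⟨ +-monoʳ-≤ _ γ≤ ⟩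
  degree G u + #non-neighbours         ≡⟨ cong (_+ #non-neighbours) (degree≡sum G u) ⟩
  ∑[ v < n ] 𝟙 (adj G u v) + #non-neighbours  ≡⟨ sum-𝟙+sum-𝟙-not (adj G u) ⟩
  n                                    ∎
  where
  open ≤-Reasoning
  #non-neighbours : ℕ
  #non-neighbours = ∑[ v < n ] 𝟙 (not (adj G u v))
  non-neighbours : Subset n
  non-neighbours = Vec.tabulate (not ∘ adj G u)
  dominating : IsDominatingSet G non-neighbours
  dominating v v∉ with adj G u v in uv | ∉-tabulate (not ∘ adj G u) v∉
  ... | true | _ = u , ∈-tabulate (not ∘ adj G u) (cong not (irrefl G u)) , uv
  γ≤ : g ≤ #non-neighbours
  γ≤ = subst (g ≤_) (∣tabulate∣ (not ∘ adj G u)) (γ-min non-neighbours dominating)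

isPositive : Fin 3 → Bool
isPositive zero    = false
isPositive (suc _) = true

isTwo : Fin 3 → Bool
isTwo (suc (suc zero)) = true
isTwo _                = false

toℕ≡𝟙+𝟙 : ∀ a → toℕ a ≡ 𝟙 (isPositive a) + 𝟙 (isTwo a)
toℕ≡𝟙+𝟙 zero             = refl
toℕ≡𝟙+𝟙 (suc zero)       = refl
toℕ≡𝟙+𝟙 (suc (suc zero)) = refl

isPositive-two : ∀ a → toℕ a ≡ 2 → isPositive a ≡ true
isPositive-two (suc (suc zero)) refl = refl

isTwo-two : ∀ a → toℕ a ≡ 2 → isTwo a ≡ true
isTwo-two (suc (suc zero)) refl = refl

toℕ-nonPositive : ∀ a → isPositive a ≡ false → toℕ a ≡ 0
toℕ-nonPositive zero refl = refl

positive : ∀ {n} → (Fin n → Fin 3) → Subset n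
positive f = Vec.tabulate (isPositive ∘ f)

#twos : ∀ {n} → (Fin n → Fin 3) → ℕ
#twos {n} f = ∑[ v < n ] 𝟙 (isTwo (f v))

weight≡∣positive∣+#twos : ∀ {n} (f : Fin n → Fin 3) → weight f ≡ ∣ positive f ∣ + #twos f
weight≡∣positive∣+#twos {n} f = begin
  weight f                                             ≡⟨ sum-map-allFin (toℕ ∘ f) ⟩
  ∑[ v < n ] toℕ (f v)                                 ≡⟨ sum-cong-≗ (toℕ≡𝟙+𝟙 ∘ f) ⟩
  ∑[ v < n ] (𝟙 (isPositive (f v)) + 𝟙 (isTwo (f v)))  ≡⟨ ∑-distrib-+ (𝟙 ∘ isPositive ∘ f) (𝟙 ∘ isTwo ∘ f) ⟩
  ∑[ v < n ] 𝟙 (isPositive (f v)) + #twos f            ≡⟨ cong (_+ #twos f) (∣tabulate∣ (isPositive ∘ f)) ⟨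
  ∣ positive f ∣ + #twos f                             ∎
  where open ≡-Reasoning

roman-mono : ∀ {n} {H G : Graph n} {f} → H ⊆G G →
  IsRomanDominatingFunction H f → IsRomanDominatingFunction G f
roman-mono H⊆G rdf v fv≡0 with rdf v fv≡0
... | u , uv , fu≡2 = u , adj-⊆ H⊆G uv , fu≡2

positive-dominating : ∀ {n} (G : Graph n) {f} → IsRomanDominatingFunction G f →
  IsDominatingSet G (positive f)
positive-dominating G {f} rdf v v∉ with f v | ∉-tabulate (isPositive ∘ f) v∉ | rdf v
... | zero | _ | zero-dominated with zero-dominated refl
...   | u , uv , fu≡2 = u , ∈-tabulate (isPositive ∘ f) (isPositive-two (f u) fu≡2) , uv

weight-without-twos : ∀ {n} (G : Graph n) {f} → IsRomanDominatingFunction G f →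
  (∀ v → toℕ (f v) ≢ 2) → weight f ≡ n
weight-without-twos {n} G {f} rdf no-two = begin
  weight f              ≡⟨ sum-map-allFin (toℕ ∘ f) ⟩
  ∑[ v < n ] toℕ (f v)  ≡⟨ sum-cong-≗ one ⟩
  ∑[ v < n ] 1          ≡⟨ sum-ones n ⟩
  n                     ∎
  where
  open ≡-Reasoning
  one : ∀ v → toℕ (f v) ≡ 1
  one v with f v in fv
  ... | zero with rdf v (cong toℕ fv)
  ...   | u , _ , fu≡2 = ⊥-elim (no-two u fu≡2)
  one v | suc zero       = refl
  one v | suc (suc zero) = ⊥-elim (no-two v (cong toℕ fv))

two-unique : ∀ {n} (f : Fin n → Fin 3) → #twos f ≤ 1 →
  ∀ {v w} → toℕ (f v) ≡ 2 → toℕ (f w) ≡ 2 → w ≡ v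
two-unique f #twos≤1 {v} {w} fv≡2 fw≡2 with w ≟ v
... | yes w≡v = w≡v
... | no  w≢v = ⊥-elim (1+n≰n (begin
  2                                  ≡⟨ cong₂ (λ a b → 𝟙 a + 𝟙 b) (isTwo-two (f w) fw≡2) (isTwo-two (f v) fv≡2) ⟨
  𝟙 (isTwo (f w)) + 𝟙 (isTwo (f v))  ≤⟨ +-≤-sum (𝟙 ∘ isTwo ∘ f) w≢v ⟩
  #twos f                            ≤⟨ #twos≤1 ⟩
  1                                  ∎))
  where open ≤-Reasoning

order≤∣positive∣+degree : ∀ {n} (H : Graph n) {f v} → IsRomanDominatingFunction H f →
  (∀ {w} → toℕ (f w) ≡ 2 → w ≡ v) → n ≤ ∣ positive f ∣ + degree H v
order≤∣positive∣+degree {n} H {f} {v} rdf only-v = begin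
  n                                                           ≤⟨ sum-𝟙-cover (isPositive ∘ f) (adj H v) zero-adjacent ⟩
  ∑[ x < n ] 𝟙 (isPositive (f x)) + ∑[ x < n ] 𝟙 (adj H v x)  ≡⟨ cong₂ _+_ (∣tabulate∣ (isPositive ∘ f)) (degree≡sum H v) ⟨
  ∣ positive f ∣ + degree H v                                 ∎
  where
  open ≤-Reasoning
  zero-adjacent : ∀ x → isPositive (f x) ≡ false → adj H v x ≡ true
  zero-adjacent x fx with rdf x (toℕ-nonPositive (f x) fx)
  ... | w , wx , fw≡2 with only-v fw≡2
  ... | refl = wx

γ≤∣positive∣ : ∀ {n} (G : Graph n) {g f} → IsDominationNumber G g →
  IsRomanDominatingFunction G f → g ≤ ∣ positive f ∣
γ≤∣positive∣ G (_ , γ-min) rdf = γ-min _ (positive-dominating G rdf)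

#twos≤1 : ∀ {n} (G : Graph n) {g f} → IsDominationNumber G g →
  IsRomanDominatingFunction G f → weight f ≡ g + 1 → #twos f ≤ 1
#twos≤1 G {g} {f} γ rdf wf = +-cancelˡ-≤ g _ _ (begin
  g + #twos f               ≤⟨ +-monoˡ-≤ (#twos f) (γ≤∣positive∣ G γ rdf) ⟩
  ∣ positive f ∣ + #twos f  ≡⟨ weight≡∣positive∣+#twos f ⟨
  weight f                  ≡⟨ wf ⟩
  g + 1                     ∎)
  where open ≤-Reasoning

∣positive∣≤γ : ∀ {n} (f : Fin n → Fin 3) {g v} → weight f ≡ g + 1 → toℕ (f v) ≡ 2 →
  ∣ positive f ∣ ≤ g
∣positive∣≤γ f {g} {v} wf fv≡2 = +-cancelʳ-≤ 1 _ _ (begin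
  ∣ positive f ∣ + 1                ≡⟨ cong (λ b → ∣ positive f ∣ + 𝟙 b) (isTwo-two (f v) fv≡2) ⟨
  ∣ positive f ∣ + 𝟙 (isTwo (f v))  ≤⟨ +-monoʳ-≤ _ (≤-sum (𝟙 ∘ isTwo ∘ f) v) ⟩
  ∣ positive f ∣ + #twos f          ≡⟨ weight≡∣positive∣+#twos f ⟨
  weight f                          ≡⟨ wf ⟩
  g + 1                             ∎)
  where open ≤-Reasoning

degree≤degree-of-two : ∀ {n} {H G : Graph n} {g f v} → H ⊆G G → IsDominationNumber G g →
  IsRomanDominatingFunction H f → weight f ≡ g + 1 → toℕ (f v) ≡ 2 →
  ∀ u → degree G u ≤ degree H v
degree≤degree-of-two {n} {H} {G} {g} {f} {v} H⊆G γ rdf wf fv≡2 u =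
  +-cancelʳ-≤ g _ _ (begin
    degree G u + g               ≤⟨ degree+γ≤order G γ u ⟩
    n                            ≤⟨ order≤∣positive∣+degree H rdf v-unique ⟩
    ∣ positive f ∣ + degree H v  ≤⟨ +-monoˡ-≤ _ (∣positive∣≤γ f wf fv≡2) ⟩
    g + degree H v               ≡⟨ +-comm g _ ⟩
    degree H v + g               ∎)
  where
  open ≤-Reasoning
  v-unique : ∀ {w} → toℕ (f w) ≡ 2 → w ≡ v
  v-unique = two-unique f (#twos≤1 G γ (roman-mono H⊆G rdf) wf) fv≡2

lemma6 : (n : ℕ) → n ≥ 3 → (G : Graph n) → Connected G →
    (g r : ℕ) → IsDominationNumber G g → IsRomanDominationNumber G r →
    r ≡ g + 1 →
    (B : EdgeSet n) → B ⊆E G → IsRomanDominationNumber (G ─ B) r →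
    Δ G ≡ Δ (G ─ B)
-- Only a Roman dominating function of G − B of weight γ(G) + 1 is used: neither B ⊆ E(G)
-- nor the value of γ_R(G) plays a role.
lemma6 n n≥3 G con g r γ _ r≡g+1 B _ ((f , rdf , wf≡r) , _) =
  ≤-antisym (Δ-lub G degree≤Δ[G─B]) (Δ-mono (─-⊆G G B))
  where
  wf : weight f ≡ g + 1
  wf = trans wf≡r r≡g+1
  degree≤Δ[G─B] : ∀ u → degree G u ≤ Δ (G ─ B)
  degree≤Δ[G─B] u with any? (λ v → toℕ (f v) ℕ.≟ 2)
  ... | yes (v , fv≡2) =
    ≤-trans (degree≤degree-of-two (─-⊆G G B) γ rdf wf fv≡2 u) (degree≤Δ (G ─ B) v)
  ... | no no-two = ⊥-elim (connected⇒¬degree≤1 G n≥3 con degree≤1)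
    where
    n≡g+1 : n ≡ g + 1
    n≡g+1 = trans (≡.sym (weight-without-twos (G ─ B) rdf (λ v fv≡2 → no-two (v , fv≡2)))) wf
    degree≤1 : ∀ y → degree G y ≤ 1
    degree≤1 y = +-cancelʳ-≤ g _ 1
      (≤-trans (degree+γ≤order G γ y) (≤-reflexive (trans n≡g+1 (+-comm g 1))))
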